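{- Let $n$ and $k$ be positive integers, and let $a_1, \ldots, a_k \in \{0, 1, \ldots, n-1\}$ with $a_1+\cdots+a_k = n$. Suppose that either $n>k$, or $n=k$ and $n$ is even. Then there exists a bipartite graph $G$ with $n$ vertices in each part whose edge set is the disjoint union of $k$ perfect matchings $M_1,\ldots,M_k$, such that there is no perfect matching $M$ of $G$ with $|M\cap M_i|=a_i$ for each $i\in\{1,\ldots,k\}$. -}

module Defs where

open import Data.Nat using (ℕ)
open import Data.Fin using (Fin; _≟_)
open import Data.Fin.Permutation using (Permutation′; _⟨$⟩ʳ_)
open import Data.Vec using (allFin; count; sum; tabulate)
open import Data.Product using (∃)
open import Relation.Binary.PropositionalEquality using (_≡_; _≢_)

-- A perfect matching of the complete bipartite graph K_{n,n} (left part and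
-- right part both Fin n) is a bijection Fin n ↔ Fin n: left vertex x is
-- matched with right vertex π x.

Σ-Fin : ∀ {k} → (Fin k → ℕ) → ℕ
Σ-Fin a = sum (tabulate a)

PairwiseDisjoint : ∀ {n k} → (Fin k → Permutation′ n) → Set
PairwiseDisjoint {n} {k} M =
  ∀ (i j : Fin k) → i ≢ j → ∀ (x : Fin n) → M i ⟨$⟩ʳ x ≢ M j ⟨$⟩ʳ x

Edge : ∀ {n k} → (Fin k → Permutation′ n) → Fin n → Fin n → Set
Edge M x y = ∃ λ i → M i ⟨$⟩ʳ x ≡ y

IsPerfectMatchingOf : ∀ {n k} → (Fin k → Permutation′ n) → Permutation′ n → Set
IsPerfectMatchingOf {n} M π = ∀ (x : Fin n) → Edge M x (π ⟨$⟩ʳ x)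

common : ∀ {n} → Permutation′ n → Permutation′ n → ℕ
common {n} π σ = count (λ x → π ⟨$⟩ʳ x ≟ σ ⟨$⟩ʳ x) (allFin n)

{-# OPTIONS --safe #-}
-- Let M_i be the rotation x ↦ x + c_i of ℤ/n, for pairwise distinct shifts c_i < n; these
-- matchings are disjoint. If π is a perfect matching of their union with |π ∩ M_i| = a_i,
-- then π x = x + c_{j(x)}, and since π permutes ℤ/n its total displacement
-- ∑_x c_{j(x)} = ∑_i c_i a_i vanishes mod n. So it suffices to choose the shifts with
-- n ∤ ∑_i c_i a_i. For n > k take c_i = i + [i ≥ t] (that is, punchIn t): moving t to t + 1
-- lowers the sum by a_t, so for any t with a_t ≠ 0 one of the two choices works. For n = k
-- the shifts form a permutation of ℤ/n; exchanging the shifts of adjacent indices t, t + 1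
-- changes the sum by a_t − a_{t+1}, so the identity or such a swap works unless a is
-- constant, i.e. a ≡ 1; then the sum is n(n − 1)/2, which the even number n does not divide.
module Submission where

open import Defs
open import Data.Nat using (ℕ; _<_; _>_; NonZero)
open import Data.Nat.Divisibility using (_∣_)
open import Data.Fin using (Fin)
open import Data.Fin.Permutation using (Permutation′)
open import Data.Product using (Σ; _×_; ∃)
open import Data.Sum using (_⊎_)
open import Relation.Nullary using (¬_)
open import Relation.Binary.PropositionalEquality using (_≡_)

open import Data.Nat
  using (zero; suc; _+_; _*_; _∸_; _≤_; z≤n; s≤s; ≢-nonZero⁻¹; >-nonZero⁻¹)
  renaming (_≟_ to _≟ℕ_)
open import Data.Nat.Properties
  using (+-*-semiring; +-assoc; +-comm; +-identityʳ; +-cancelˡ-≡;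
         *-assoc; *-identityʳ; *-zeroʳ; *-distribʳ-+; *-cancelʳ-≡; *-cancelˡ-≡;
         <⇒≤; ≤-trans; m<m*n; m∸n+n≡m; m+[n∸m]≡n)
open import Data.Nat.DivMod
  using (_%_; _/_; m%n<n; m%n≤n; m%n%n≡m%n; [m+n]%n≡m%n; m≡m%n+[m/n]*n; m<n⇒m%n≡m;
         %-distribˡ-+; %-remove-+ˡ)
open import Data.Nat.Divisibility using (_∤_; _∣?_; divides; ∣-refl; m∣m*n)
open import Data.Nat.Tactic.RingSolver using (solve-∀)
open import Data.Fin using (zero; suc; toℕ; fromℕ<; inject₁; punchIn; _≟_)
open import Data.Fin.Properties
  using (toℕ-fromℕ<; toℕ-injective; toℕ<n; punchIn-injective; punchInᵢ≢i; ¬∀⟶∃¬)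
open import Data.Fin.Permutation using (_⟨$⟩ʳ_; permutation)
open import Data.Vec using (count; tabulate)
open import Data.Product using (_,_; proj₁; proj₂)
open import Data.Sum using (inj₁; inj₂; [_,_]′)
open import Function using (_∘_; id)
open import Function.Definitions using (Injective)
open import Relation.Nullary using (Dec; yes; no; contradiction)
open import Relation.Unary using (Pred; Decidable)
open import Relation.Binary.PropositionalEquality
  using (_≢_; refl; sym; trans; cong; cong₂; subst; module ≡-Reasoning)
open import Algebra.Properties.Semiring.Sum +-*-semiring
  using (∑-distrib-+; ∑-comm; sum-permute; sum-cong-≗; sum-remove; sum-replicate-zero;
         *-distribˡ-sum; *-distribʳ-sum)
  renaming (sum to ∑)

open ≡-Reasoning

%-+-cong : ∀ {m n o p d} .{{_ : NonZero d}} →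
           m % d ≡ o % d → n % d ≡ p % d → (m + n) % d ≡ (o + p) % d
%-+-cong {m} {n} {o} {p} {d} m≡o n≡p = begin
  (m + n) % d          ≡⟨ %-distribˡ-+ m n d ⟩
  (m % d + n % d) % d  ≡⟨ cong₂ (λ u v → (u + v) % d) m≡o n≡p ⟩
  (o % d + p % d) % d  ≡⟨ %-distribˡ-+ o p d ⟨
  (o + p) % d          ∎

%-cancelˡ-+ : ∀ m {n o d} .{{_ : NonZero d}} → (m + n) % d ≡ (m + o) % d → n % d ≡ o % d
%-cancelˡ-+ m {n} {o} {d} eq = begin
  n % d              ≡⟨ complement n ⟩
  (r + (m + n)) % d  ≡⟨ %-+-cong {r} refl eq ⟩
  (r + (m + o)) % d  ≡⟨ complement o ⟨
  o % d              ∎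
  where
  r = d ∸ m % d
  complement : ∀ x → x % d ≡ (r + (m + x)) % d
  complement x = begin
    x % d                  ≡⟨ %-remove-+ˡ x ∣-refl ⟨
    (d + x) % d            ≡⟨ cong (λ z → (z + x) % d) (m∸n+n≡m (m%n≤n m d)) ⟨
    (r + m % d + x) % d    ≡⟨ cong (_% d) (+-assoc r (m % d) x) ⟩
    (r + (m % d + x)) % d  ≡⟨ %-+-cong {r} refl (%-+-cong (m%n%n≡m%n m d) refl) ⟩
    (r + (m + x)) % d      ∎

remainder-unique : ∀ {d m o a b} .{{_ : NonZero d}} → d ∣ m → d ∣ o →
                   m + a ≡ o + b → a < d → b < d → a ≡ b
remainder-unique {d} {m} {o} {a} {b} d∣m d∣o eq a<d b<d = begin
  a            ≡⟨ m<n⇒m%n≡m a<d ⟨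
  a % d        ≡⟨ %-remove-+ˡ a d∣m ⟨
  (m + a) % d  ≡⟨ cong (_% d) eq ⟩
  (o + b) % d  ≡⟨ %-remove-+ˡ b d∣o ⟩
  b % d        ≡⟨ m<n⇒m%n≡m b<d ⟩
  b            ∎

∤-either : ∀ {d m o a b} .{{_ : NonZero d}} →
           m + a ≡ o + b → a ≢ b → a < d → b < d → d ∤ m ⊎ d ∤ o
∤-either {d} {o = o} eq a≢b a<d b<d with d ∣? o
... | yes d∣o = inj₁ λ d∣m → a≢b (remainder-unique d∣m d∣o eq a<d b<d)
... | no  d∤o = inj₂ d∤o

rotate : ∀ n .{{_ : NonZero n}} → ℕ → Fin n → Fin n
rotate n c x = fromℕ< (m%n<n (toℕ x + c) n)

toℕ-rotate : ∀ n .{{_ : NonZero n}} c x → toℕ (rotate n c x) ≡ (toℕ x + c) % n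
toℕ-rotate n c x = toℕ-fromℕ< (m%n<n (toℕ x + c) n)

rotate-rotate : ∀ n .{{_ : NonZero n}} {c c′} → c + c′ ≡ n →
                ∀ x → rotate n c′ (rotate n c x) ≡ x
rotate-rotate n {c} {c′} c+c′≡n x = toℕ-injective (begin
  toℕ (rotate n c′ (rotate n c x))  ≡⟨ toℕ-rotate n c′ _ ⟩
  (toℕ (rotate n c x) + c′) % n     ≡⟨ cong (λ z → (z + c′) % n) (toℕ-rotate n c x) ⟩
  ((toℕ x + c) % n + c′) % n        ≡⟨ %-+-cong (m%n%n≡m%n (toℕ x + c) n) refl ⟩
  (toℕ x + c + c′) % n              ≡⟨ cong (_% n) (+-assoc (toℕ x) c c′) ⟩
  (toℕ x + (c + c′)) % n            ≡⟨ cong (λ z → (toℕ x + z) % n) c+c′≡n ⟩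
  (toℕ x + n) % n                   ≡⟨ [m+n]%n≡m%n (toℕ x) n ⟩
  toℕ x % n                         ≡⟨ m<n⇒m%n≡m (toℕ<n x) ⟩
  toℕ x                             ∎)

rotation : ∀ n .{{_ : NonZero n}} c → c ≤ n → Permutation′ n
rotation n c c≤n = permutation (rotate n c) (rotate n (n ∸ c))
  (rotate-rotate n (m∸n+n≡m c≤n))
  (rotate-rotate n (m+[n∸m]≡n c≤n))

rotate-injectiveˡ : ∀ n .{{_ : NonZero n}} {c c′} x →
                    rotate n c x ≡ rotate n c′ x → c < n → c′ < n → c ≡ c′
rotate-injectiveˡ n {c} {c′} x eq c<n c′<n = begin
  c       ≡⟨ m<n⇒m%n≡m c<n ⟨
  c % n   ≡⟨ %-cancelˡ-+ (toℕ x) x+c≡x+c′ ⟩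
  c′ % n  ≡⟨ m<n⇒m%n≡m c′<n ⟩
  c′      ∎
  where
  x+c≡x+c′ : (toℕ x + c) % n ≡ (toℕ x + c′) % n
  x+c≡x+c′ = trans (sym (toℕ-rotate n c x)) (trans (cong toℕ eq) (toℕ-rotate n c′ x))

n∣∑-displacement : ∀ {n} .{{_ : NonZero n}} (σ : Permutation′ n) (f : Fin n → ℕ) →
                   (∀ x → toℕ (σ ⟨$⟩ʳ x) ≡ (toℕ x + f x) % n) → n ∣ ∑ f
n∣∑-displacement {n} σ f σ≡x+f = divides (∑ q) (+-cancelˡ-≡ (∑ (toℕ {n})) (∑ f) (∑ q * n) total)
  where
  q : Fin n → ℕ
  q x = (toℕ x + f x) / n

  σx : Fin n → ℕ
  σx x = toℕ (σ ⟨$⟩ʳ x)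

  x+f≡σx+qn : ∀ x → toℕ x + f x ≡ σx x + q x * n
  x+f≡σx+qn x = begin
    toℕ x + f x                  ≡⟨ m≡m%n+[m/n]*n (toℕ x + f x) n ⟩
    (toℕ x + f x) % n + q x * n  ≡⟨ cong (_+ q x * n) (σ≡x+f x) ⟨
    σx x + q x * n               ∎

  total : ∑ (toℕ {n}) + ∑ f ≡ ∑ (toℕ {n}) + ∑ q * n
  total = begin
    ∑ (toℕ {n}) + ∑ f             ≡⟨ ∑-distrib-+ toℕ f ⟨
    ∑ (λ x → toℕ x + f x)         ≡⟨ sum-cong-≗ x+f≡σx+qn ⟩
    ∑ (λ x → σx x + q x * n)      ≡⟨ ∑-distrib-+ σx (λ x → q x * n) ⟩
    ∑ σx + ∑ (λ x → q x * n)      ≡⟨ cong₂ _+_ (sum-permute toℕ σ) (*-distribʳ-sum n q) ⟨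
    ∑ (toℕ {n}) + ∑ q * n         ∎

χ : ∀ {p} {P : Set p} → Dec P → ℕ
χ (yes _) = 1
χ (no _)  = 0

χ-yes : ∀ {p} {P : Set p} (P? : Dec P) → P → χ P? ≡ 1
χ-yes (yes _) _  = refl
χ-yes (no ¬p) p = contradiction p ¬p

χ-no : ∀ {p} {P : Set p} (P? : Dec P) → ¬ P → χ P? ≡ 0
χ-no (yes p) ¬p = contradiction p ¬p
χ-no (no _)  _  = refl

count-tabulate : ∀ {a p m} {A : Set a} {P : Pred A p}
                 (P? : Decidable P) (f : Fin m → A) →
                 count P? (tabulate f) ≡ ∑ (λ x → χ (P? (f x)))
count-tabulate {m = zero}  P? f = refl
count-tabulate {m = suc m} P? f with P? (f zero)
... | yes _ = cong suc (count-tabulate P? (f ∘ suc))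
... | no  _ = count-tabulate P? (f ∘ suc)

Σ-Fin≡∑ : ∀ {k} (a : Fin k → ℕ) → Σ-Fin a ≡ ∑ a
Σ-Fin≡∑ {zero}  a = refl
Σ-Fin≡∑ {suc k} a = cong (a zero +_) (Σ-Fin≡∑ (a ∘ suc))

∑-zero : ∀ {k} {f : Fin k → ℕ} → (∀ i → f i ≡ 0) → ∑ f ≡ 0
∑-zero {k} f≡0 = trans (sum-cong-≗ f≡0) (sum-replicate-zero k)

∑-const : ∀ k x → ∑ (λ (_ : Fin k) → x) ≡ k * x
∑-const zero    x = refl
∑-const (suc k) x = cong (x +_) (∑-const k x)

∑-single : ∀ {k} (g : Fin k → ℕ) j → (∀ i → i ≢ j → g i ≡ 0) → ∑ g ≡ g j
∑-single {suc k} g j g≡0 = begin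
  ∑ g                      ≡⟨ sum-remove {i = j} g ⟩
  g j + ∑ (g ∘ punchIn j)  ≡⟨ cong (g j +_) (∑-zero (λ i → g≡0 (punchIn j i) (punchInᵢ≢i j i))) ⟩
  g j + 0                  ≡⟨ +-identityʳ (g j) ⟩
  g j                      ∎

weight : ∀ {k} → (Fin k → ℕ) → (Fin k → ℕ) → ℕ
weight c a = ∑ (λ i → c i * a i)

weight-suc : ∀ {k} (c a : Fin k → ℕ) → weight (suc ∘ c) a ≡ ∑ a + weight c a
weight-suc c a = ∑-distrib-+ a (λ i → c i * a i)

record DistinctShifts (n k : ℕ) : Set where
  field
    shift           : Fin k → ℕ
    shift<n         : ∀ i → shift i < n
    shift-injective : Injective _≡_ _≡_ shift

open DistinctShifts

module _ {n k} .{{_ : NonZero n}} (c : DistinctShifts n k) where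

  rotations : Fin k → Permutation′ n
  rotations i = rotation n (shift c i) (<⇒≤ (shift<n c i))

  rotations-disjoint : PairwiseDisjoint rotations
  rotations-disjoint i j i≢j x eq =
    i≢j (shift-injective c (rotate-injectiveˡ n x eq (shift<n c i) (shift<n c j)))

  n∣weight : ∀ (a : Fin k → ℕ) π → IsPerfectMatchingOf rotations π →
             (∀ i → common π (rotations i) ≡ a i) → n ∣ weight (shift c) a
  n∣weight a π π⊆G π∩M≡a = subst (n ∣_) ∑D≡weight (n∣∑-displacement π D π≡x+D)
    where
    agrees? : ∀ i x → Dec (π ⟨$⟩ʳ x ≡ rotations i ⟨$⟩ʳ x)
    agrees? i x = π ⟨$⟩ʳ x ≟ rotations i ⟨$⟩ʳ x

    agrees : Fin k → Fin n → ℕ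
    agrees i x = χ (agrees? i x)

    D : Fin n → ℕ
    D x = ∑ (λ i → shift c i * agrees i x)

    D≡shift : ∀ x j → rotations j ⟨$⟩ʳ x ≡ π ⟨$⟩ʳ x → D x ≡ shift c j
    D≡shift x j Mj≡π = begin
      D x                      ≡⟨ ∑-single _ j off-j ⟩
      shift c j * agrees j x   ≡⟨ cong (shift c j *_) (χ-yes _ (sym Mj≡π)) ⟩
      shift c j * 1            ≡⟨ *-identityʳ (shift c j) ⟩
      shift c j                ∎
      where
      off-j : ∀ i → i ≢ j → shift c i * agrees i x ≡ 0
      off-j i i≢j = trans (cong (shift c i *_) (χ-no _ π≢Mi)) (*-zeroʳ (shift c i))
        where
        π≢Mi : π ⟨$⟩ʳ x ≢ rotations i ⟨$⟩ʳ x
        π≢Mi π≡Mi = rotations-disjoint i j i≢j x (trans (sym π≡Mi) (sym Mj≡π))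

    π≡x+D : ∀ x → toℕ (π ⟨$⟩ʳ x) ≡ (toℕ x + D x) % n
    π≡x+D x with j , Mj≡π ← π⊆G x = begin
      toℕ (π ⟨$⟩ʳ x)            ≡⟨ cong toℕ Mj≡π ⟨
      toℕ (rotations j ⟨$⟩ʳ x)  ≡⟨ toℕ-rotate n (shift c j) x ⟩
      (toℕ x + shift c j) % n   ≡⟨ cong (λ s → (toℕ x + s) % n) (D≡shift x j Mj≡π) ⟨
      (toℕ x + D x) % n         ∎

    ∑D≡weight : ∑ D ≡ weight (shift c) a
    ∑D≡weight = begin
      ∑ D                                         ≡⟨ ∑-comm (λ x i → shift c i * agrees i x) ⟩
      ∑ (λ i → ∑ (λ x → shift c i * agrees i x))  ≡⟨ sum-cong-≗ distrib ⟨
      ∑ (λ i → shift c i * ∑ (agrees i))          ≡⟨ sum-cong-≗ (cong (shift c _ *_) ∘ ∑agrees≡a) ⟩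
      weight (shift c) a                          ∎
      where
      distrib : ∀ i → shift c i * ∑ (agrees i) ≡ ∑ (λ x → shift c i * agrees i x)
      distrib i = *-distribˡ-sum (shift c i) (agrees i)

      ∑agrees≡a : ∀ i → ∑ (agrees i) ≡ a i
      ∑agrees≡a i = begin
        ∑ (agrees i)            ≡⟨ count-tabulate (agrees? i) id ⟨
        common π (rotations i)  ≡⟨ π∩M≡a i ⟩
        a i                     ∎

AvoidingShifts : ∀ n {k} → (Fin k → ℕ) → Set
AvoidingShifts n {k} a = Σ (DistinctShifts n k) λ c → n ∤ weight (shift c) a

punchInShifts : ∀ {n k} → k < n → Fin (suc k) → DistinctShifts n k
punchInShifts k<n t = record
  { shift           = toℕ ∘ punchIn t
  ; shift<n         = λ i → ≤-trans (toℕ<n (punchIn t i)) k<n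
  ; shift-injective = punchIn-injective t _ _ ∘ toℕ-injective
  }

weight-punchIn : ∀ {k} (a : Fin k → ℕ) t →
                 weight (toℕ ∘ punchIn (inject₁ t)) a
                 ≡ weight (toℕ ∘ punchIn (suc t)) a + a t
weight-punchIn {suc k} a zero = begin
  a zero + 0 + r  ≡⟨ cong (_+ r) (+-identityʳ (a zero)) ⟩
  a zero + r      ≡⟨ +-comm (a zero) r ⟩
  r + a zero      ∎
  where r = weight (λ i → 2 + toℕ i) (a ∘ suc)
weight-punchIn {suc k} a (suc t) = begin
  weight (suc ∘ c₁) b        ≡⟨ weight-suc c₁ b ⟩
  ∑ b + weight c₁ b          ≡⟨ cong (∑ b +_) (weight-punchIn b t) ⟩
  ∑ b + (weight c₂ b + b t)  ≡⟨ +-assoc (∑ b) _ (b t) ⟨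
  ∑ b + weight c₂ b + b t    ≡⟨ cong (_+ b t) (weight-suc c₂ b) ⟨
  weight (suc ∘ c₂) b + b t  ∎
  where
  b = a ∘ suc
  c₁ = toℕ ∘ punchIn (inject₁ t)
  c₂ = toℕ ∘ punchIn (suc t)

avoidingShifts-< : ∀ {n k} .{{_ : NonZero n}} (a : Fin k → ℕ) →
                   (∀ i → a i < n) → ∑ a ≡ n → k < n → AvoidingShifts n a
avoidingShifts-< {n} {k} a a<n ∑a≡n k<n =
  [ (λ n∤ → punchInShifts k<n (inject₁ t) , n∤) , (λ n∤ → punchInShifts k<n (suc t) , n∤) ]′
    (∤-either (trans (+-identityʳ _) (weight-punchIn a t)) (aₜ≢0 ∘ sym) (>-nonZero⁻¹ n) (a<n t))
  where
  a≢0 : ¬ (∀ i → a i ≡ 0)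
  a≢0 a≡0 = ≢-nonZero⁻¹ n (trans (sym ∑a≡n) (∑-zero a≡0))
  nonzero : ∃ λ t → a t ≢ 0
  nonzero = ¬∀⟶∃¬ k _ (λ i → a i ≟ℕ 0) a≢0
  t = proj₁ nonzero
  aₜ≢0 = proj₂ nonzero

swapAdjacent : ∀ {k} → Fin k → Fin (suc k) → Fin (suc k)
swapAdjacent zero    zero          = suc zero
swapAdjacent zero    (suc zero)    = zero
swapAdjacent zero    (suc (suc i)) = suc (suc i)
swapAdjacent (suc t) zero          = zero
swapAdjacent (suc t) (suc i)       = suc (swapAdjacent t i)

swapAdjacent-involutive : ∀ {k} (t : Fin k) i → swapAdjacent t (swapAdjacent t i) ≡ i
swapAdjacent-involutive zero    zero          = refl
swapAdjacent-involutive zero    (suc zero)    = refl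
swapAdjacent-involutive zero    (suc (suc i)) = refl
swapAdjacent-involutive (suc t) zero          = refl
swapAdjacent-involutive (suc t) (suc i)       = cong suc (swapAdjacent-involutive t i)

idShifts : ∀ {n} → DistinctShifts n n
idShifts = record { shift = toℕ ; shift<n = toℕ<n ; shift-injective = toℕ-injective }

swapShifts : ∀ {k} → Fin k → DistinctShifts (suc k) (suc k)
swapShifts t = record
  { shift           = toℕ ∘ swapAdjacent t
  ; shift<n         = toℕ<n ∘ swapAdjacent t
  ; shift-injective = λ {i} {j} eq → begin
      i                                  ≡⟨ swapAdjacent-involutive t i ⟨
      swapAdjacent t (swapAdjacent t i)  ≡⟨ cong (swapAdjacent t) (toℕ-injective eq) ⟩
      swapAdjacent t (swapAdjacent t j)  ≡⟨ swapAdjacent-involutive t j ⟩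
      j                                  ∎
  }

weight-swapAdjacent : ∀ {k} (a : Fin (suc k) → ℕ) t →
                      weight (toℕ ∘ swapAdjacent t) a + a (suc t)
                      ≡ weight toℕ a + a (inject₁ t)
weight-swapAdjacent {suc k} a zero = exchange (a zero) (a (suc zero)) _
  where
  exchange : ∀ x y r → (1 * x + (0 * y + r)) + y ≡ (0 * x + (1 * y + r)) + x
  exchange = solve-∀
weight-swapAdjacent {suc k} a (suc t) = begin
  weight (suc ∘ c) b + b (suc t)        ≡⟨ cong (_+ b (suc t)) (weight-suc c b) ⟩
  ∑ b + weight c b + b (suc t)          ≡⟨ +-assoc (∑ b) _ _ ⟩
  ∑ b + (weight c b + b (suc t))        ≡⟨ cong (∑ b +_) (weight-swapAdjacent b t) ⟩
  ∑ b + (weight toℕ b + b (inject₁ t))  ≡⟨ +-assoc (∑ b) _ _ ⟨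
  ∑ b + weight toℕ b + b (inject₁ t)    ≡⟨ cong (_+ b (inject₁ t)) (weight-suc toℕ b) ⟨
  weight (suc ∘ toℕ) b + b (inject₁ t)  ∎
  where
  b = a ∘ suc
  c = toℕ ∘ swapAdjacent t

adjacent-≢-or-constant : ∀ {k} (a : Fin (suc k) → ℕ) →
                         (∃ λ t → a (inject₁ t) ≢ a (suc t)) ⊎ (∀ i → a i ≡ a zero)
adjacent-≢-or-constant {zero}  a = inj₂ λ { zero → refl }
adjacent-≢-or-constant {suc k} a with a zero ≟ℕ a (suc zero)
... | no a₀≢a₁ = inj₁ (zero , a₀≢a₁)
... | yes a₀≡a₁ with adjacent-≢-or-constant (a ∘ suc)
...   | inj₁ (t , a≢) = inj₁ (suc t , a≢)
...   | inj₂ a≡a₁     = inj₂ λ { zero → refl ; (suc i) → trans (a≡a₁ i) (sym a₀≡a₁) }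

∑toℕ*2+n≡n*n : ∀ n → ∑ (toℕ {n}) * 2 + n ≡ n * n
∑toℕ*2+n≡n*n zero    = refl
∑toℕ*2+n≡n*n (suc n) = begin
  ∑ (suc ∘ toℕ {n}) * 2 + suc n            ≡⟨ cong (λ s → s * 2 + suc n) (∑-distrib-+ _ (toℕ {n})) ⟩
  (∑ (λ (_ : Fin n) → 1) + T) * 2 + suc n  ≡⟨ cong (λ s → (s + T) * 2 + suc n) (∑-const n 1) ⟩
  (n * 1 + T) * 2 + suc n                  ≡⟨ regroup n T ⟩
  (T * 2 + n) + (n + n + 1)                ≡⟨ cong (_+ (n + n + 1)) (∑toℕ*2+n≡n*n n) ⟩
  n * n + (n + n + 1)                      ≡⟨ square-suc n ⟩
  suc n * suc n                            ∎
  where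
  T = ∑ (toℕ {n})
  regroup : ∀ n t → (n * 1 + t) * 2 + suc n ≡ (t * 2 + n) + (n + n + 1)
  regroup = solve-∀
  square-suc : ∀ n → n * n + (n + n + 1) ≡ suc n * suc n
  square-suc = solve-∀

n∤∑toℕ : ∀ n .{{_ : NonZero n}} → 2 ∣ n → n ∤ ∑ (toℕ {n})
n∤∑toℕ n (divides zero n≡0) _ = ≢-nonZero⁻¹ n n≡0
n∤∑toℕ n (divides q@(suc _) n≡q*2) n∣T =
  contradiction (remainder-unique (m∣m*n q) n∣T nq+0≡T+q (>-nonZero⁻¹ n) q<n) (λ ())
  where
  T = ∑ (toℕ {n})
  nq+0≡T+q : n * q + 0 ≡ T + q
  nq+0≡T+q = trans (+-identityʳ (n * q)) (sym (*-cancelʳ-≡ (T + q) (n * q) 2 (begin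
    (T + q) * 2    ≡⟨ *-distribʳ-+ 2 T q ⟩
    T * 2 + q * 2  ≡⟨ cong (T * 2 +_) n≡q*2 ⟨
    T * 2 + n      ≡⟨ ∑toℕ*2+n≡n*n n ⟩
    n * n          ≡⟨ cong (n *_) n≡q*2 ⟩
    n * (q * 2)    ≡⟨ *-assoc n q 2 ⟨
    n * q * 2      ∎)))
  q<n : q < n
  q<n = subst (q <_) (sym n≡q*2) (m<m*n q 2 (s≤s (s≤s z≤n)))

avoidingShifts-even : ∀ {k} (a : Fin (suc k) → ℕ) → (∀ i → a i < suc k) →
                      ∑ a ≡ suc k → 2 ∣ suc k → AvoidingShifts (suc k) a
avoidingShifts-even {k} a a<n ∑a≡n 2∣n with adjacent-≢-or-constant a
... | inj₁ (t , a≢) =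
  [ (λ n∤ → swapShifts t , n∤) , (λ n∤ → idShifts , n∤) ]′
    (∤-either (weight-swapAdjacent a t) (a≢ ∘ sym) (a<n (suc t)) (a<n (inject₁ t)))
... | inj₂ a≡a₀ = idShifts , subst (suc k ∤_) (sym weight≡∑toℕ) (n∤∑toℕ (suc k) 2∣n)
  where
  a₀≡1 : a zero ≡ 1
  a₀≡1 = *-cancelˡ-≡ (a zero) 1 (suc k) (begin
    suc k * a zero                    ≡⟨ ∑-const (suc k) (a zero) ⟨
    ∑ (λ (_ : Fin (suc k)) → a zero)  ≡⟨ sum-cong-≗ a≡a₀ ⟨
    ∑ a                               ≡⟨ ∑a≡n ⟩
    suc k                             ≡⟨ *-identityʳ (suc k) ⟨
    suc k * 1                         ∎)

  weight≡∑toℕ : weight toℕ a ≡ ∑ (toℕ {suc k})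
  weight≡∑toℕ = sum-cong-≗ λ i → begin
    toℕ i * a i  ≡⟨ cong (toℕ i *_) (trans (a≡a₀ i) a₀≡1) ⟩
    toℕ i * 1    ≡⟨ *-identityʳ (toℕ i) ⟩
    toℕ i        ∎

proposition1p1 : (n k : ℕ) → NonZero n → NonZero k →
    (a : Fin k → ℕ) → (∀ i → a i < n) → Σ-Fin a ≡ n →
    (n > k ⊎ (n ≡ k × 2 ∣ n)) →
    Σ (Fin k → Permutation′ n) λ M →
      PairwiseDisjoint M ×
      ¬ (∃ λ (π : Permutation′ n) →
           IsPerfectMatchingOf M π × (∀ i → common π (M i) ≡ a i))
proposition1p1 zero    _ () _ _ _ _ _
proposition1p1 (suc m) k _  _ a a<n Σa≡n cases =
  rotations c , rotations-disjoint c , λ (π , π⊆G , π∩M≡a) → n∤ (n∣weight c a π π⊆G π∩M≡a)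
  where
  ∑a≡n : ∑ a ≡ suc m
  ∑a≡n = trans (sym (Σ-Fin≡∑ a)) Σa≡n
  avoiding : (suc m > k ⊎ (suc m ≡ k × 2 ∣ suc m)) → AvoidingShifts (suc m) a
  avoiding (inj₁ k<n)         = avoidingShifts-< a a<n ∑a≡n k<n
  avoiding (inj₂ (refl , 2∣n)) = avoidingShifts-even a a<n ∑a≡n 2∣n
  c  = proj₁ (avoiding cases)
  n∤ = proj₂ (avoiding cases)
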